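{- Let $G$ be a group, $H$ a subgroup of $G$ and $g\in G$. If $H=(H\cap g^{ -1}Hg)(gHg^{ -1}\cap H)$ and $g\notin N_G(H)$, then $g^{ -1}\notin HgH$. -}

module Defs where

open import Level using (Level; _⊔_; suc)
open import Algebra.Bundles using (Group)
open import Data.Product using (Σ; ∃; _×_; _,_)
open import Relation.Nullary using (¬_)
open import Function.Bundles using (_⇔_)

module _ {c ℓ : Level} (G : Group c ℓ) where
  open Group G

  record IsSubgroup {p : Level} (H : Carrier → Set p) : Set (c ⊔ ℓ ⊔ p) where
    field
      resp   : ∀ {x y} → x ≈ y → H x → H y
      ε∈     : H ε
      ∙-closed : ∀ {x y} → H x → H y → H (x ∙ y)
      ⁻¹-closed : ∀ {x} → H x → H (x ⁻¹)

  conjˡ : ∀ {p} → Carrier → (Carrier → Set p) → Carrier → Set (c ⊔ ℓ ⊔ p)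
  conjˡ g H x = Σ Carrier λ h → H h × (x ≈ (g ⁻¹ ∙ h) ∙ g)

  conjʳ : ∀ {p} → Carrier → (Carrier → Set p) → Carrier → Set (c ⊔ ℓ ⊔ p)
  conjʳ g H x = Σ Carrier λ h → H h × (x ≈ (g ∙ h) ∙ g ⁻¹)

  _∩_ : ∀ {p q} → (Carrier → Set p) → (Carrier → Set q) → Carrier → Set (p ⊔ q)
  (A ∩ B) x = A x × B x

  _·_ : ∀ {p q} → (Carrier → Set p) → (Carrier → Set q) → Carrier → Set (c ⊔ ℓ ⊔ p ⊔ q)
  (A · B) x = Σ Carrier λ a → Σ Carrier λ b → A a × B b × (x ≈ a ∙ b)

  _≐_ : ∀ {p q} → (Carrier → Set p) → (Carrier → Set q) → Set (c ⊔ p ⊔ q)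
  A ≐ B = ∀ x → A x ⇔ B x

  Normalizer : ∀ {p} → (Carrier → Set p) → Carrier → Set (c ⊔ ℓ ⊔ p)
  Normalizer H g = conjʳ g H ≐ H

  doubleCoset : ∀ {p} → (Carrier → Set p) → Carrier → Carrier → Set (c ⊔ ℓ ⊔ p)
  doubleCoset H g x = Σ Carrier λ h → Σ Carrier λ k → H h × H k × (x ≈ (h ∙ g) ∙ k)

-- Write the hypothesis as H = AB with A = H ∩ g⁻¹Hg and B = gHg⁻¹ ∩ H, so every
-- h ∈ H is (g⁻¹dg)(gcg⁻¹) with c, d ∈ H. If g⁻¹ = hgk with h, k ∈ H, factor k in
-- this way: the inner g's cancel and leave g⁻¹ = (hd)g²cg⁻¹, so g² ∈ H. With
-- g² ∈ H the same factorisation gives ghg⁻¹ = dg²cg⁻² ∈ H and g⁻¹hg = g⁻²dg²c ∈ H,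
-- i.e. g ∈ N_G(H).
module Submission where

open import Defs
open import Level using (_⊔_)
open import Algebra.Bundles using (Group)
open import Relation.Nullary using (¬_)
open import Data.Product using (Σ-syntax; _×_; _,_)
open import Function.Bundles using (mk⇔; Equivalence)
import Algebra.Properties.Group as GroupProperties
import Algebra.Solver.Monoid as MonoidSolver
import Relation.Binary.Reasoning.Setoid as SetoidReasoning

module _ {c ℓ} (G : Group c ℓ) where
  open Group G
  open GroupProperties G using (inverseʳ-unique; x≈z//y; //-rightDividesʳ; ⁻¹-anti-homo-∙)
  open MonoidSolver monoid using (solve; _⊜_; _⊕_)
  open SetoidReasoning setoid

  g∙g⁻¹dg≈dg : ∀ g d → g ∙ ((g ⁻¹ ∙ d) ∙ g) ≈ d ∙ g
  g∙g⁻¹dg≈dg g d = begin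
    g ∙ ((g ⁻¹ ∙ d) ∙ g)   ≈⟨ solve 3 (λ g g⁻¹ d → g ⊕ ((g⁻¹ ⊕ d) ⊕ g) ⊜ (g ⊕ g⁻¹) ⊕ (d ⊕ g)) refl g (g ⁻¹) d ⟩
    (g ∙ g ⁻¹) ∙ (d ∙ g)   ≈⟨ ∙-congʳ (inverseʳ g) ⟩
    ε ∙ (d ∙ g)            ≈⟨ identityˡ _ ⟩
    d ∙ g                  ∎

  gcg⁻¹∙g≈gc : ∀ g c → ((g ∙ c) ∙ g ⁻¹) ∙ g ≈ g ∙ c
  gcg⁻¹∙g≈gc g c = begin
    ((g ∙ c) ∙ g ⁻¹) ∙ g   ≈⟨ assoc _ _ _ ⟩
    (g ∙ c) ∙ (g ⁻¹ ∙ g)   ≈⟨ ∙-congˡ (inverseˡ g) ⟩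
    (g ∙ c) ∙ ε            ≈⟨ identityʳ _ ⟩
    g ∙ c                  ∎

  module _ {p} {H : Carrier → Set p} (H-subgroup : IsSubgroup G H) where
    open IsSubgroup H-subgroup

    conjugation-closed⇒Normalizer : ∀ g →
      (∀ {x} → H x → H ((g ∙ x) ∙ g ⁻¹)) →
      (∀ {x} → H x → H ((g ⁻¹ ∙ x) ∙ g)) →
      Normalizer G H g
    conjugation-closed⇒Normalizer g gHg⁻¹⊆H g⁻¹Hg⊆H x = mk⇔ to from
      where
      to : conjʳ G g H x → H x
      to (h , h∈H , x≈ghg⁻¹) = resp (sym x≈ghg⁻¹) (gHg⁻¹⊆H h∈H)

      from : H x → conjʳ G g H x
      from x∈H = (g ⁻¹ ∙ x) ∙ g , g⁻¹Hg⊆H x∈H , sym (begin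
        (g ∙ ((g ⁻¹ ∙ x) ∙ g)) ∙ g ⁻¹   ≈⟨ ∙-congʳ (g∙g⁻¹dg≈dg g x) ⟩
        (x ∙ g) ∙ g ⁻¹                  ≈⟨ //-rightDividesʳ g x ⟩
        x                               ∎)

    module _ (g : Carrier)
             (H≐AB : _≐_ G H (_·_ G (_∩_ G H (conjˡ G g H)) (_∩_ G (conjʳ G g H) H))) where

      Factorisation : Carrier → Set (c ⊔ ℓ ⊔ p)
      Factorisation x = Σ[ d ∈ Carrier ] Σ[ c ∈ Carrier ]
        H d × H c × x ≈ ((g ⁻¹ ∙ d) ∙ g) ∙ ((g ∙ c) ∙ g ⁻¹)

      factorise : ∀ {x} → H x → Factorisation x
      factorise {x} x∈H with Equivalence.to (H≐AB x) x∈H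
      ... | a , b , (_ , d , d∈H , a≈) , ((c , c∈H , b≈) , _) , x≈ab =
        d , c , d∈H , c∈H , trans x≈ab (∙-cong a≈ b≈)

      g⁻¹∈HgH⇒g²∈H : doubleCoset G H g (g ⁻¹) → H (g ∙ g)
      g⁻¹∈HgH⇒g²∈H (h , k , h∈H , k∈H , g⁻¹≈hgk) with factorise k∈H
      ... | d , c , d∈H , c∈H , k≈ = resp g²≈ (∙-closed (⁻¹-closed (∙-closed h∈H d∈H)) (⁻¹-closed c∈H))
        where
        hd∙g²c≈ε : (h ∙ d) ∙ ((g ∙ g) ∙ c) ≈ ε
        hd∙g²c≈ε = begin
          (h ∙ d) ∙ ((g ∙ g) ∙ c)
            ≈⟨ solve 4 (λ h d g c → (h ⊕ d) ⊕ ((g ⊕ g) ⊕ c) ⊜ (h ⊕ (d ⊕ g)) ⊕ (g ⊕ c)) refl h d g c ⟩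
          (h ∙ (d ∙ g)) ∙ (g ∙ c)
            ≈⟨ ∙-cong (∙-congˡ (g∙g⁻¹dg≈dg g d)) (gcg⁻¹∙g≈gc g c) ⟨
          (h ∙ (g ∙ ((g ⁻¹ ∙ d) ∙ g))) ∙ (((g ∙ c) ∙ g ⁻¹) ∙ g)
            ≈⟨ solve 4 (λ h g a b → (h ⊕ (g ⊕ a)) ⊕ (b ⊕ g) ⊜ ((h ⊕ g) ⊕ (a ⊕ b)) ⊕ g) refl h g _ _ ⟩
          ((h ∙ g) ∙ (((g ⁻¹ ∙ d) ∙ g) ∙ ((g ∙ c) ∙ g ⁻¹))) ∙ g
            ≈⟨ ∙-congʳ (trans g⁻¹≈hgk (∙-congˡ k≈)) ⟨
          g ⁻¹ ∙ g
            ≈⟨ inverseˡ g ⟩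
          ε ∎

        g²≈ : (h ∙ d) ⁻¹ ∙ c ⁻¹ ≈ g ∙ g
        g²≈ = sym (x≈z//y (g ∙ g) c _ (inverseʳ-unique _ _ hd∙g²c≈ε))

      module _ (g²∈H : H (g ∙ g)) where

        g⁻²∈H : H (g ⁻¹ ∙ g ⁻¹)
        g⁻²∈H = resp (⁻¹-anti-homo-∙ g g) (⁻¹-closed g²∈H)

        gHg⁻¹⊆H : ∀ {x} → H x → H ((g ∙ x) ∙ g ⁻¹)
        gHg⁻¹⊆H {x} x∈H with factorise x∈H
        ... | d , c , d∈H , c∈H , x≈ =
          resp (sym gxg⁻¹≈) (∙-closed d∈H (∙-closed g²∈H (∙-closed c∈H g⁻²∈H)))
          where
          gxg⁻¹≈ : (g ∙ x) ∙ g ⁻¹ ≈ d ∙ ((g ∙ g) ∙ (c ∙ (g ⁻¹ ∙ g ⁻¹)))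
          gxg⁻¹≈ = begin
            (g ∙ x) ∙ g ⁻¹
              ≈⟨ ∙-congʳ (∙-congˡ x≈) ⟩
            (g ∙ (((g ⁻¹ ∙ d) ∙ g) ∙ ((g ∙ c) ∙ g ⁻¹))) ∙ g ⁻¹
              ≈⟨ solve 4 (λ g a c g⁻¹ → (g ⊕ (a ⊕ ((g ⊕ c) ⊕ g⁻¹))) ⊕ g⁻¹ ⊜ (g ⊕ a) ⊕ ((g ⊕ c) ⊕ (g⁻¹ ⊕ g⁻¹))) refl g _ c (g ⁻¹) ⟩
            (g ∙ ((g ⁻¹ ∙ d) ∙ g)) ∙ ((g ∙ c) ∙ (g ⁻¹ ∙ g ⁻¹))
              ≈⟨ ∙-congʳ (g∙g⁻¹dg≈dg g d) ⟩
            (d ∙ g) ∙ ((g ∙ c) ∙ (g ⁻¹ ∙ g ⁻¹))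
              ≈⟨ solve 4 (λ d g c g⁻¹ → (d ⊕ g) ⊕ ((g ⊕ c) ⊕ g⁻¹) ⊜ d ⊕ ((g ⊕ g) ⊕ (c ⊕ g⁻¹))) refl d g c _ ⟩
            d ∙ ((g ∙ g) ∙ (c ∙ (g ⁻¹ ∙ g ⁻¹))) ∎

        g⁻¹Hg⊆H : ∀ {x} → H x → H ((g ⁻¹ ∙ x) ∙ g)
        g⁻¹Hg⊆H {x} x∈H with factorise x∈H
        ... | d , c , d∈H , c∈H , x≈ =
          resp (sym g⁻¹xg≈) (∙-closed g⁻²∈H (∙-closed d∈H (∙-closed g²∈H c∈H)))
          where
          g⁻¹xg≈ : (g ⁻¹ ∙ x) ∙ g ≈ (g ⁻¹ ∙ g ⁻¹) ∙ (d ∙ ((g ∙ g) ∙ c))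
          g⁻¹xg≈ = begin
            (g ⁻¹ ∙ x) ∙ g
              ≈⟨ ∙-congʳ (∙-congˡ x≈) ⟩
            (g ⁻¹ ∙ (((g ⁻¹ ∙ d) ∙ g) ∙ ((g ∙ c) ∙ g ⁻¹))) ∙ g
              ≈⟨ solve 5 (λ g⁻¹ d g b g' → (g⁻¹ ⊕ (((g⁻¹ ⊕ d) ⊕ g) ⊕ b)) ⊕ g' ⊜ ((g⁻¹ ⊕ g⁻¹) ⊕ (d ⊕ g)) ⊕ (b ⊕ g')) refl (g ⁻¹) d g _ g ⟩
            ((g ⁻¹ ∙ g ⁻¹) ∙ (d ∙ g)) ∙ (((g ∙ c) ∙ g ⁻¹) ∙ g)
              ≈⟨ ∙-congˡ (gcg⁻¹∙g≈gc g c) ⟩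
            ((g ⁻¹ ∙ g ⁻¹) ∙ (d ∙ g)) ∙ (g ∙ c)
              ≈⟨ solve 4 (λ g⁻² d g c → (g⁻² ⊕ (d ⊕ g)) ⊕ (g ⊕ c) ⊜ g⁻² ⊕ (d ⊕ ((g ⊕ g) ⊕ c))) refl _ d g c ⟩
            (g ⁻¹ ∙ g ⁻¹) ∙ (d ∙ ((g ∙ g) ∙ c)) ∎

lemma2p3 : ∀ {c ℓ p} (G : Group c ℓ) (H : Group.Carrier G → Set p) → IsSubgroup G H → (g : Group.Carrier G) → _≐_ G H (_·_ G (_∩_ G H (conjˡ G g H)) (_∩_ G (conjʳ G g H) H)) → ¬ Normalizer G H g → ¬ doubleCoset G H g (Group._⁻¹ G g)
lemma2p3 G H H-subgroup g H≐AB g∉N g⁻¹∈HgH = g∉N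
  (conjugation-closed⇒Normalizer G H-subgroup g
    (gHg⁻¹⊆H G H-subgroup g H≐AB g²∈H) (g⁻¹Hg⊆H G H-subgroup g H≐AB g²∈H))
  where
  open Group G using (_∙_)
  g²∈H : H (g ∙ g)
  g²∈H = g⁻¹∈HgH⇒g²∈H G H-subgroup g H≐AB g⁻¹∈HgH
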